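{- Every matroid of rank $3$ is CI-compliant, and hence also AK-compliant.
   Context: A polymatroid is $(Q,f)$ with $Q$ finite, $f(\emptyset)=0$, $f$ monotone and submodular; a matroid is an integer-valued polymatroid with $f(X)\le|X|$. Write $f(Y\mid X)=f(X\cup Y)-f(X)$ and $f(Y:Z)=f(Y)+f(Z)-f(Y\cup Z)$. An extension of $(Q,f)$ is a polymatroid $(Q',f')$ with $Q\subseteq Q'$ and $f'=f$ on subsets of $Q$. Given $A,B\subseteq Q$, an element $x_o$ is a common information for $(A,B)$ if $f(\{x_o\}\mid A)=f(\{x_o\}\mid B)=0$ and $f(\{x_o\})=f(A:B)$. $(Q,f)$ is 1-CI-compliant if for every pair $A,B\subseteq Q$ there is an extension $(Q\cup\{x_o\},f)$ in which $x_o$ is a common information for $(A,B)$; for $k>1$ it is $k$-CI-compliant if for every pair there is such an extension that is moreover $(k-1)$-CI-compliant; it is CI-compliant if it is $k$-CI-compliant for all $k\ge1$. Given $U,V,Z\subseteq Q$, an element $z_o$ is an AK-information for $(U,V,Z)$ if $f(\{z_o\}\mid U\cup V)=0$, $f(U\mid \{z_o\})=f(U\mid Z)$, $f(V\mid\{z_o\})=f(V\mid Z)$, and $f(U\cup V\mid\{z_o\})=f(U\cup V\mid Z)$. $k$-AK-compliance and AK-compliance are defined analogously to the CI notions, with triples $(U,V,Z)$ and AK-information in place of pairs and common information. -}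

module Defs where

open import Data.Nat using (ℕ; zero; suc)
open import Data.Integer using (ℤ; +_)
open import Data.Rational using (ℚ; _+_; _-_; _≤_; _/_; 0ℚ)
open import Data.Vec using (_∷_)
open import Data.Fin.Subset using (Subset; inside; outside; _∪_; _∩_; _⊆_; ⊥; ⊤; ∣_∣)
open import Data.Product using (Σ; ∃; _×_)
open import Relation.Binary.PropositionalEquality using (_≡_)
import Data.Unit as U

SetFn : ℕ → Set
SetFn n = Subset n → ℚ

ℕ→ℚ : ℕ → ℚ
ℕ→ℚ m = (+ m) / 1

record IsPolymatroid {n : ℕ} (f : SetFn n) : Set where
  field
    normalized  : f ⊥ ≡ 0ℚ
    monotone    : ∀ X Y → X ⊆ Y → f X ≤ f Y
    submodular  : ∀ X Y → (f (X ∪ Y) + f (X ∩ Y)) ≤ (f X + f Y)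

record IsMatroid {n : ℕ} (f : SetFn n) : Set where
  field
    polymatroid    : IsPolymatroid f
    integerValued  : ∀ X → ∃ λ (z : ℤ) → f X ≡ z / 1
    boundedBySize  : ∀ X → f X ≤ ℕ→ℚ ∣ X ∣

HasRank : {n : ℕ} → SetFn n → ℕ → Set
HasRank f r = f ⊤ ≡ ℕ→ℚ r

cond : {n : ℕ} → SetFn n → Subset n → Subset n → ℚ
cond f Y X = f (X ∪ Y) - f X

mutInf : {n : ℕ} → SetFn n → Subset n → Subset n → ℚ
mutInf f Y Z = (f Y + f Z) - f (Y ∪ Z)

-- One-element extension Q ∪ {xₒ}: the new element xₒ is index zero of Fin (suc n);
-- a subset X ⊆ Q is identified with  outside ∷ X.
lift : {n : ℕ} → Subset n → Subset (suc n)
lift X = outside ∷ X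

new : {n : ℕ} → Subset (suc n)
new = inside ∷ ⊥

IsExtension : {n : ℕ} → SetFn n → SetFn (suc n) → Set
IsExtension f g = IsPolymatroid g × (∀ X → g (lift X) ≡ f X)

IsCommonInfo : {n : ℕ} → SetFn (suc n) → Subset n → Subset n → Set
IsCommonInfo g A B =
  (cond g new (lift A) ≡ 0ℚ) × (cond g new (lift B) ≡ 0ℚ)
  × (g new ≡ mutInf g (lift A) (lift B))

IsAKInfo : {n : ℕ} → SetFn (suc n) → Subset n → Subset n → Subset n → Set
IsAKInfo g U V Z =
  (cond g new (lift (U ∪ V)) ≡ 0ℚ)
  × (cond g (lift U) new ≡ cond g (lift U) (lift Z))
  × (cond g (lift V) new ≡ cond g (lift V) (lift Z))
  × (cond g (lift (U ∪ V)) new ≡ cond g (lift (U ∪ V)) (lift Z))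

-- k-CI-compliance (0-CI-compliance is vacuous, so suc 0 gives 1-CI-compliance)
CICompliantK : ℕ → {n : ℕ} → SetFn n → Set
CICompliantK zero f = U.⊤
CICompliantK (suc k) {n} f =
  ∀ (A B : Subset n) → ∃ λ (g : SetFn (suc n)) →
    IsExtension f g × IsCommonInfo g A B × CICompliantK k g

CICompliant : {n : ℕ} → SetFn n → Set
CICompliant f = ∀ (k : ℕ) → CICompliantK k f

AKCompliantK : ℕ → {n : ℕ} → SetFn n → Set
AKCompliantK zero f = U.⊤
AKCompliantK (suc k) {n} f =
  ∀ (U V Z : Subset n) → ∃ λ (g : SetFn (suc n)) →
    IsExtension f g × IsAKInfo g U V Z × AKCompliantK k g

AKCompliant : {n : ℕ} → SetFn n → Set
AKCompliant f = ∀ (k : ℕ) → AKCompliantK k f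

-- A rank-3 matroid is an integer polymatroid of rank at most 3, and this larger class is
-- closed under adjoining a common information of any pair (A, B); CI-compliance then follows
-- by induction on k. If some subset S already meets the common-information conditions, adjoin
-- a parallel copy of S. Otherwise the ranks are forced to be h A = h B = 2, h (A ∪ B) = 3: two
-- lines of the plane whose intersection point is missing. Adjoin that point. The sets spanning
-- A or B form a modular cut: if X spans A, Y spans B and (X, Y) is a modular pair, then in
-- rank 3 either one of X, Y spans both lines or X ∩ Y is a point on both, i.e. already a
-- common information. The new point raises the rank of every set outside the cut by one.
-- Finally, a common information of Z and U ∪ V is an AK-information for (U, V, Z), so
-- AK-compliance follows in the same way.

module Submission where

open import Defs
open import Data.Nat using (ℕ)
open import Data.Product using (_×_)

open import Data.Nat using (suc; zero; _+_; _≤_; _<_; s≤s; _≟_)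
open import Data.Nat.Properties
  using (≤-refl; ≤-reflexive; n≤1+n; ≤-trans; ≤-antisym; ≤-pred; ≤∧≢⇒<; m≤m+n; +-comm; +-assoc; +-suc;
         +-mono-≤; +-monoˡ-≤; +-monoʳ-≤; +-cancelˡ-≤; +-cancelʳ-≤; +-cancelˡ-≡;
         +-commutativeSemigroup; module ≤-Reasoning)
open import Algebra.Properties.CommutativeSemigroup +-commutativeSemigroup
  using (xy∙z≈xz∙y; x∙yz≈z∙xy)
import Algebra.Solver.IdempotentCommutativeMonoid as ICM-Solver
open import Data.Bool using (true; false; if_then_else_)
open import Data.Vec using (_∷_; here)
open import Data.Fin.Subset using (Subset; inside; outside; _∪_; _∩_; _⊆_; ⊤) renaming (⊥ to ∅)
open import Data.Fin.Subset.Properties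
  using (⊆-refl; ⊆-trans; ⊆⊤; drop-∷-⊆; out⊆; p⊆p∪q; q⊆p∪q; p∩q⊆p; p∩q⊆q; x∈p∪q⁻; x∈p∩q⁺;
         ⊆-min; ∪-assoc; ∪-comm; ∪-idem; ∪-identityˡ; ∪-identityʳ; ∪-zeroˡ; ∩-comm; ∪-distribʳ-∩;
         ∪-idempotentCommutativeMonoid; anySubset?)
open import Data.Product using (∃; _,_; proj₁; proj₂)
open import Data.Sum using (_⊎_; inj₁; inj₂)
import Data.Sum as Sum
open import Data.Empty using (⊥-elim)
open import Data.Unit using (tt)
open import Relation.Nullary using (¬_; Dec; yes; no; does)
open import Relation.Nullary.Decidable using (_×-dec_; _⊎-dec_; dec-true; dec-false; toSum)
open import Relation.Unary using (Decidable)
open import Relation.Binary.PropositionalEquality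
  using (_≡_; refl; sym; trans; cong; cong₂; subst; subst₂; module ≡-Reasoning)
open import Data.Nat.Coprimality as Coprimality using (1-coprimeTo)
open import Data.Integer as ℤ using (-[1+_]; +≤+)
import Data.Integer.Properties as ℤₚ
import Data.Rational as ℚ
import Data.Rational.Properties as ℚₚ
import Data.Rational.Unnormalised as ℚᵘ
import Data.Rational.Unnormalised.Properties as ℚᵘₚ
open import Data.Rational.Solver using (module +-*-Solver)

module _ {n : ℕ} where

  ∪-lub : {X Y Z : Subset n} → X ⊆ Z → Y ⊆ Z → X ∪ Y ⊆ Z
  ∪-lub {X} {Y} X⊆Z Y⊆Z x∈X∪Y with x∈p∪q⁻ X Y x∈X∪Y
  ... | inj₁ x∈X = X⊆Z x∈X
  ... | inj₂ x∈Y = Y⊆Z x∈Y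

  ∩-glb : {X Y Z : Subset n} → Z ⊆ X → Z ⊆ Y → Z ⊆ X ∩ Y
  ∩-glb Z⊆X Z⊆Y x∈Z = x∈p∩q⁺ (Z⊆X x∈Z , Z⊆Y x∈Z)

  ∪-distribʳ-∪ : ∀ (S X Y : Subset n) → (X ∪ Y) ∪ S ≡ (X ∪ S) ∪ (Y ∪ S)
  ∪-distribʳ-∪ = solve 3 (λ S X Y → (X ⊕ Y) ⊕ S ⊜ (X ⊕ S) ⊕ (Y ⊕ S)) refl
    where open ICM-Solver (∪-idempotentCommutativeMonoid n)

  ∪-mono-⊆ : {X X′ Y Y′ : Subset n} → X ⊆ X′ → Y ⊆ Y′ → X ∪ Y ⊆ X′ ∪ Y′
  ∪-mono-⊆ {X′ = X′} {Y′ = Y′} X⊆X′ Y⊆Y′ =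
    ∪-lub (⊆-trans X⊆X′ (p⊆p∪q Y′)) (⊆-trans Y⊆Y′ (q⊆p∪q X′ Y′))

-- Integer polymatroids

record IsIntPolymatroid {n : ℕ} (h : Subset n → ℕ) : Set where
  field
    normalized : h ∅ ≡ 0
    monotone   : {X Y : Subset n} → X ⊆ Y → h X ≤ h Y
    submodular : ∀ X Y → h (X ∪ Y) + h (X ∩ Y) ≤ h X + h Y

module _ {n : ℕ} (h : Subset n → ℕ) where

  Spans : Subset n → Subset n → Set
  Spans X S = h (X ∪ S) ≡ h X

  IsModularPair : Subset n → Subset n → Set
  IsModularPair X Y = h (X ∪ Y) + h (X ∩ Y) ≡ h X + h Y

  IsCommonInfoSet : Subset n → Subset n → Subset n → Set
  IsCommonInfoSet S A B = Spans A S × Spans B S × h S + h (A ∪ B) ≡ h A + h B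

  spans? : ∀ X S → Dec (Spans X S)
  spans? X S = h (X ∪ S) ≟ h X

  isCommonInfoSet? : ∀ A B S → Dec (IsCommonInfoSet S A B)
  isCommonInfoSet? A B S = spans? A S ×-dec spans? B S ×-dec (h S + h (A ∪ B) ≟ h A + h B)

isModularPair-comm : ∀ {n} {h : Subset n → ℕ} {X Y} → IsModularPair h X Y → IsModularPair h Y X
isModularPair-comm {h = h} {X} {Y} mod =
  trans (cong₂ _+_ (cong h (∪-comm Y X)) (cong h (∩-comm Y X))) (trans mod (+-comm (h X) (h Y)))

module IntPolymatroid {n : ℕ} {h : Subset n → ℕ} (poly : IsIntPolymatroid h) where
  open IsIntPolymatroid poly
  open ≤-Reasoning

  spans-refl : ∀ X → Spans h X X
  spans-refl X = cong h (∪-idem X)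

  spans-∅ : ∀ X → Spans h X ∅
  spans-∅ X = cong h (∪-identityʳ X)

  spans⇒≤ : ∀ {X S} → Spans h X S → h S ≤ h X
  spans⇒≤ {X} {S} X↠S = ≤-trans (monotone (q⊆p∪q X S)) (≤-reflexive X↠S)

  spans-mono : ∀ {X Y S} → X ⊆ Y → Spans h X S → Spans h Y S
  spans-mono {X} {Y} {S} X⊆Y X↠S = ≤-antisym (+-cancelʳ-≤ (h X) _ _ le) (monotone (p⊆p∪q S))
    where
    le : h (Y ∪ S) + h X ≤ h Y + h X
    le = begin
      h (Y ∪ S) + h X                   ≤⟨ +-mono-≤ (monotone (∪-lub (q⊆p∪q (X ∪ S) Y)
                                                                     (⊆-trans (q⊆p∪q X S) (p⊆p∪q Y))))
                                                     (monotone (∩-glb (p⊆p∪q S) X⊆Y)) ⟩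
      h ((X ∪ S) ∪ Y) + h ((X ∪ S) ∩ Y) ≤⟨ submodular (X ∪ S) Y ⟩
      h (X ∪ S) + h Y                   ≡⟨ cong (_+ h Y) X↠S ⟩
      h X + h Y                         ≡⟨ +-comm (h X) (h Y) ⟩
      h Y + h X                         ∎

  spans-restrict : ∀ {X Y S} → X ⊆ Y → h X ≡ h Y → Spans h Y S → Spans h X S
  spans-restrict {X} {Y} {S} X⊆Y hX≡hY Y↠S = ≤-antisym le (monotone (p⊆p∪q S))
    where
    le : h (X ∪ S) ≤ h X
    le = begin
      h (X ∪ S) ≤⟨ monotone (∪-mono-⊆ X⊆Y ⊆-refl) ⟩
      h (Y ∪ S) ≡⟨ Y↠S ⟩
      h Y       ≡⟨ sym hX≡hY ⟩
      h X       ∎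

  spans-∪ : ∀ {X S T} → Spans h X S → Spans h X T → Spans h X (S ∪ T)
  spans-∪ {X} {S} {T} X↠S X↠T = begin-equality
    h (X ∪ (S ∪ T)) ≡⟨ cong h (sym (∪-assoc X S T)) ⟩
    h ((X ∪ S) ∪ T) ≡⟨ spans-mono (p⊆p∪q S) X↠T ⟩
    h (X ∪ S)       ≡⟨ X↠S ⟩
    h X             ∎

  spans-∩ : ∀ {X Y S} → IsModularPair h X Y → Spans h X S → Spans h Y S → Spans h (X ∩ Y) S
  spans-∩ {X} {Y} {S} mod X↠S Y↠S = ≤-antisym (+-cancelˡ-≤ (h (X ∪ Y)) _ _ le) (monotone (p⊆p∪q S))
    where
    le : h (X ∪ Y) + h ((X ∩ Y) ∪ S) ≤ h (X ∪ Y) + h (X ∩ Y)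
    le = begin
      h (X ∪ Y) + h ((X ∩ Y) ∪ S)                   ≤⟨ +-mono-≤ (monotone (∪-mono-⊆ (p⊆p∪q S) (p⊆p∪q S)))
                                                                 (≤-reflexive (cong h (∪-distribʳ-∩ S X Y))) ⟩
      h ((X ∪ S) ∪ (Y ∪ S)) + h ((X ∪ S) ∩ (Y ∪ S)) ≤⟨ submodular (X ∪ S) (Y ∪ S) ⟩
      h (X ∪ S) + h (Y ∪ S)                         ≡⟨ cong₂ _+_ X↠S Y↠S ⟩
      h X + h Y                                     ≡⟨ sym mod ⟩
      h (X ∪ Y) + h (X ∩ Y)                         ∎

  spans-subset : ∀ {X S T} → Spans h X S → h X ≡ h S → T ⊆ X → Spans h S T
  spans-subset {X} {S} {T} X↠S hX≡hS T⊆X = ≤-antisym le (monotone (p⊆p∪q T))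
    where
    le : h (S ∪ T) ≤ h S
    le = begin
      h (S ∪ T) ≤⟨ monotone (∪-lub (q⊆p∪q X S) (⊆-trans T⊆X (p⊆p∪q S))) ⟩
      h (X ∪ S) ≡⟨ X↠S ⟩
      h X       ≡⟨ hX≡hS ⟩
      h S       ∎

  -- f(T | x) = f(T | Z), with the subtractions moved across.
  commonInfo-conditional : ∀ {x Z W T} → IsCommonInfoSet h x Z W → T ⊆ W
                         → h (x ∪ T) + h Z ≡ h (Z ∪ T) + h x
  commonInfo-conditional {x} {Z} {W} {T} (Z↠x , W↠x , modular) T⊆W = ≤-antisym upper lower
    where
    lower : h (Z ∪ T) + h x ≤ h (x ∪ T) + h Z
    lower = begin
      h (Z ∪ T) + h x                               ≤⟨ +-mono-≤ (monotone ZT⊆) (monotone (∩-glb (p⊆p∪q T) (q⊆p∪q Z x))) ⟩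
      h ((x ∪ T) ∪ (Z ∪ x)) + h ((x ∪ T) ∩ (Z ∪ x)) ≤⟨ submodular (x ∪ T) (Z ∪ x) ⟩
      h (x ∪ T) + h (Z ∪ x)                         ≡⟨ cong (h (x ∪ T) +_) Z↠x ⟩
      h (x ∪ T) + h Z                               ∎
      where
      ZT⊆ : Z ∪ T ⊆ (x ∪ T) ∪ (Z ∪ x)
      ZT⊆ = ∪-lub (⊆-trans (p⊆p∪q x) (q⊆p∪q (x ∪ T) (Z ∪ x))) (⊆-trans (q⊆p∪q x T) (p⊆p∪q (Z ∪ x)))

    ZW⊆ : Z ∪ W ⊆ ((Z ∪ T) ∪ x) ∪ (W ∪ x)
    ZW⊆ = ∪-mono-⊆ (⊆-trans (p⊆p∪q T) (p⊆p∪q x)) (p⊆p∪q x)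

    xT⊆ : x ∪ T ⊆ ((Z ∪ T) ∪ x) ∩ (W ∪ x)
    xT⊆ = ∩-glb (∪-lub (q⊆p∪q (Z ∪ T) x) (⊆-trans (q⊆p∪q Z T) (p⊆p∪q x)))
                (∪-lub (q⊆p∪q W x) (⊆-trans T⊆W (p⊆p∪q x)))

    transfer : h (Z ∪ W) + h (x ∪ T) ≤ h (Z ∪ T) + h W
    transfer = begin
      h (Z ∪ W) + h (x ∪ T)                                     ≤⟨ +-mono-≤ (monotone ZW⊆) (monotone xT⊆) ⟩
      h (((Z ∪ T) ∪ x) ∪ (W ∪ x)) + h (((Z ∪ T) ∪ x) ∩ (W ∪ x)) ≤⟨ submodular ((Z ∪ T) ∪ x) (W ∪ x) ⟩
      h ((Z ∪ T) ∪ x) + h (W ∪ x)                               ≡⟨ cong₂ _+_ (spans-mono (p⊆p∪q T) Z↠x) W↠x ⟩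
      h (Z ∪ T) + h W                                           ∎

    upper : h (x ∪ T) + h Z ≤ h (Z ∪ T) + h x
    upper = +-cancelˡ-≤ (h (Z ∪ W)) _ _ (begin
      h (Z ∪ W) + (h (x ∪ T) + h Z) ≡⟨ sym (+-assoc (h (Z ∪ W)) _ _) ⟩
      h (Z ∪ W) + h (x ∪ T) + h Z   ≤⟨ +-monoˡ-≤ (h Z) transfer ⟩
      h (Z ∪ T) + h W + h Z         ≡⟨ xy∙z≈xz∙y (h (Z ∪ T)) (h W) (h Z) ⟩
      h (Z ∪ T) + h Z + h W         ≡⟨ +-assoc (h (Z ∪ T)) (h Z) (h W) ⟩
      h (Z ∪ T) + (h Z + h W)       ≡⟨ cong (h (Z ∪ T) +_) (sym modular) ⟩
      h (Z ∪ T) + (h x + h (Z ∪ W)) ≡⟨ x∙yz≈z∙xy (h (Z ∪ T)) (h x) (h (Z ∪ W)) ⟩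
      h (Z ∪ W) + (h (Z ∪ T) + h x) ∎)

-- One-element extensions

-- H X is the rank of X together with the new element.
extend : ∀ {n} → (Subset n → ℕ) → (Subset n → ℕ) → Subset (suc n) → ℕ
extend h H (outside ∷ X) = h X
extend h H (inside  ∷ X) = H X

record Extends {n : ℕ} (h H : Subset n → ℕ) : Set where
  field
    h≤H              : ∀ X → h X ≤ H X
    monotone         : {X Y : Subset n} → X ⊆ Y → H X ≤ H Y
    submodular       : ∀ X Y → H (X ∪ Y) + H (X ∩ Y) ≤ H X + H Y
    submodular-mixed : ∀ X Y → H (X ∪ Y) + h (X ∩ Y) ≤ h X + H Y

extend-isIntPolymatroid : ∀ {n} {h H : Subset n → ℕ} → IsIntPolymatroid h → Extends h H
                        → IsIntPolymatroid (extend h H)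
extend-isIntPolymatroid {h = h} {H} poly ext = record
  { normalized = P.normalized
  ; monotone   = mono
  ; submodular = sub
  }
  where
  module P = IsIntPolymatroid poly
  module E = Extends ext

  mono : ∀ {X Y} → X ⊆ Y → extend h H X ≤ extend h H Y
  mono {outside ∷ X} {outside ∷ Y} X⊆Y = P.monotone (drop-∷-⊆ X⊆Y)
  mono {outside ∷ X} {inside  ∷ Y} X⊆Y = ≤-trans (P.monotone (drop-∷-⊆ X⊆Y)) (E.h≤H Y)
  mono {inside  ∷ X} {inside  ∷ Y} X⊆Y = E.monotone (drop-∷-⊆ X⊆Y)
  mono {inside  ∷ X} {outside ∷ Y} X⊆Y with X⊆Y here
  ... | ()

  sub : ∀ X Y → extend h H (X ∪ Y) + extend h H (X ∩ Y) ≤ extend h H X + extend h H Y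
  sub (outside ∷ X) (outside ∷ Y) = P.submodular X Y
  sub (outside ∷ X) (inside  ∷ Y) = E.submodular-mixed X Y
  sub (inside  ∷ X) (outside ∷ Y) =
    subst₂ _≤_ (cong₂ _+_ (cong H (∪-comm Y X)) (cong h (∩-comm Y X))) (+-comm (h Y) (H X))
      (E.submodular-mixed Y X)
  sub (inside  ∷ X) (inside  ∷ Y) = E.submodular X Y

extend-commonInfo : ∀ {n} {h H : Subset n → ℕ} {A B} → H A ≡ h A → H B ≡ h B
                  → H ∅ + h (A ∪ B) ≡ h A + h B
                  → IsCommonInfoSet (extend h H) new (lift A) (lift B)
extend-commonInfo {H = H} {A} {B} HA≡hA HB≡hB modular =
  trans (cong H (∪-identityʳ A)) HA≡hA , trans (cong H (∪-identityʳ B)) HB≡hB , modular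

record CommonInfoExtension {n : ℕ} (h : Subset n → ℕ) (A B : Subset n) : Set where
  field
    H          : Subset n → ℕ
    extends    : Extends h H
    H⊤≡h⊤      : H ⊤ ≡ h ⊤
    commonInfo : IsCommonInfoSet (extend h H) new (lift A) (lift B)

module _ {n : ℕ} {h : Subset n → ℕ} (poly : IsIntPolymatroid h) where
  open IsIntPolymatroid poly
  open ≤-Reasoning

  copy-extends : ∀ S → Extends h (λ X → h (X ∪ S))
  copy-extends S = record
    { h≤H              = λ X → monotone (p⊆p∪q S)
    ; monotone         = λ X⊆Y → monotone (∪-mono-⊆ X⊆Y ⊆-refl)
    ; submodular       = sub
    ; submodular-mixed = mixed
    }
    where
    sub : ∀ X Y → h ((X ∪ Y) ∪ S) + h ((X ∩ Y) ∪ S) ≤ h (X ∪ S) + h (Y ∪ S)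
    sub X Y = begin
      h ((X ∪ Y) ∪ S) + h ((X ∩ Y) ∪ S)             ≡⟨ cong₂ _+_ (cong h (∪-distribʳ-∪ S X Y)) (cong h (∪-distribʳ-∩ S X Y)) ⟩
      h ((X ∪ S) ∪ (Y ∪ S)) + h ((X ∪ S) ∩ (Y ∪ S)) ≤⟨ submodular (X ∪ S) (Y ∪ S) ⟩
      h (X ∪ S) + h (Y ∪ S)                         ∎

    mixed : ∀ X Y → h ((X ∪ Y) ∪ S) + h (X ∩ Y) ≤ h X + h (Y ∪ S)
    mixed X Y = begin
      h ((X ∪ Y) ∪ S) + h (X ∩ Y)       ≤⟨ +-mono-≤ (≤-reflexive (cong h (∪-assoc X Y S)))
                                                    (monotone (∩-glb (p∩q⊆p X Y) (⊆-trans (p∩q⊆q X Y) (p⊆p∪q S)))) ⟩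
      h (X ∪ (Y ∪ S)) + h (X ∩ (Y ∪ S)) ≤⟨ submodular X (Y ∪ S) ⟩
      h X + h (Y ∪ S)                   ∎

  copy-commonInfo : ∀ {S A B} → IsCommonInfoSet h S A B
                  → IsCommonInfoSet (extend h (λ X → h (X ∪ S))) new (lift A) (lift B)
  copy-commonInfo {S} {A} {B} (A↠S , B↠S , modular) =
    extend-commonInfo {H = λ X → h (X ∪ S)} {A} {B} A↠S B↠S
      (trans (cong (λ T → h T + h (A ∪ B)) (∪-identityˡ S)) modular)

record IsModularCut {n : ℕ} (h : Subset n → ℕ) (M : Subset n → Set) : Set where
  field
    upward    : ∀ {X Y} → X ⊆ Y → M X → M Y
    closed    : ∀ {X Y} → X ⊆ Y → h X ≡ h Y → M Y → M X
    modular-∩ : ∀ {X Y} → IsModularPair h X Y → M X → M Y → M (X ∩ Y)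

-- The new element lies in the span of exactly the sets of the modular cut M.
module ModularCutExtension {n : ℕ} {h : Subset n → ℕ} (poly : IsIntPolymatroid h)
         {M : Subset n → Set} (M? : Decidable M) (cut : IsModularCut h M) where
  open IsIntPolymatroid poly
  open IsModularCut cut
  open ≤-Reasoning

  rank : Subset n → ℕ
  rank X = if does (M? X) then h X else suc (h X)

  rank-∈ : ∀ {X} → M X → rank X ≡ h X
  rank-∈ {X} X∈M rewrite dec-true (M? X) X∈M = refl

  rank-∉ : ∀ {X} → ¬ M X → rank X ≡ suc (h X)
  rank-∉ {X} X∉M rewrite dec-false (M? X) X∉M = refl

  h≤rank : ∀ X → h X ≤ rank X
  h≤rank X with does (M? X)
  ... | true  = ≤-refl
  ... | false = n≤1+n (h X)

  rank≤suc : ∀ X → rank X ≤ suc (h X)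
  rank≤suc X with does (M? X)
  ... | true  = n≤1+n (h X)
  ... | false = ≤-refl

  private
    suc-+-mono-≤ : ∀ {a b c d} → a + b ≤ c + d → suc a + suc b ≤ suc c + suc d
    suc-+-mono-≤ {a} {b} {c} {d} le = s≤s (subst₂ _≤_ (sym (+-suc a b)) (sym (+-suc c d)) (s≤s le))

  rank-monotone : ∀ {X Y} → X ⊆ Y → rank X ≤ rank Y
  rank-monotone {X} {Y} X⊆Y with toSum (M? X) | toSum (M? Y)
  ... | inj₁ X∈M | _ = begin
    rank X ≡⟨ rank-∈ X∈M ⟩
    h X    ≤⟨ monotone X⊆Y ⟩
    h Y    ≤⟨ h≤rank Y ⟩
    rank Y ∎
  ... | inj₂ X∉M | inj₁ Y∈M = begin
    rank X    ≡⟨ rank-∉ X∉M ⟩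
    suc (h X) ≤⟨ ≤∧≢⇒< (monotone X⊆Y) (λ hX≡hY → X∉M (closed X⊆Y hX≡hY Y∈M)) ⟩
    h Y       ≡⟨ rank-∈ Y∈M ⟨
    rank Y    ∎
  ... | inj₂ X∉M | inj₂ Y∉M = begin
    rank X    ≡⟨ rank-∉ X∉M ⟩
    suc (h X) ≤⟨ s≤s (monotone X⊆Y) ⟩
    suc (h Y) ≡⟨ rank-∉ Y∉M ⟨
    rank Y    ∎

  rank-submodular-∈∉ : ∀ {X Y} → M X → ¬ M Y → rank (X ∪ Y) + rank (X ∩ Y) ≤ rank X + rank Y
  rank-submodular-∈∉ {X} {Y} X∈M Y∉M = begin
    rank (X ∪ Y) + rank (X ∩ Y)   ≤⟨ +-mono-≤ (≤-reflexive (rank-∈ (upward (p⊆p∪q Y) X∈M))) (rank≤suc (X ∩ Y)) ⟩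
    h (X ∪ Y) + suc (h (X ∩ Y))   ≡⟨ +-suc (h (X ∪ Y)) (h (X ∩ Y)) ⟩
    suc (h (X ∪ Y) + h (X ∩ Y))   ≤⟨ s≤s (submodular X Y) ⟩
    suc (h X + h Y)               ≡⟨ +-suc (h X) (h Y) ⟨
    h X + suc (h Y)               ≡⟨ cong₂ _+_ (rank-∈ X∈M) (rank-∉ Y∉M) ⟨
    rank X + rank Y               ∎

  rank-submodular-∈∈ : ∀ {X Y} → M X → M Y → rank (X ∪ Y) + rank (X ∩ Y) ≤ rank X + rank Y
  rank-submodular-∈∈ {X} {Y} X∈M Y∈M with toSum (M? (X ∩ Y))
  ... | inj₁ X∩Y∈M = begin
    rank (X ∪ Y) + rank (X ∩ Y) ≡⟨ cong₂ _+_ (rank-∈ X∪Y∈M) (rank-∈ X∩Y∈M) ⟩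
    h (X ∪ Y) + h (X ∩ Y)       ≤⟨ submodular X Y ⟩
    h X + h Y                   ≡⟨ cong₂ _+_ (rank-∈ X∈M) (rank-∈ Y∈M) ⟨
    rank X + rank Y             ∎
    where X∪Y∈M = upward (p⊆p∪q Y) X∈M
  ... | inj₂ X∩Y∉M = begin
    rank (X ∪ Y) + rank (X ∩ Y) ≡⟨ cong₂ _+_ (rank-∈ X∪Y∈M) (rank-∉ X∩Y∉M) ⟩
    h (X ∪ Y) + suc (h (X ∩ Y)) ≡⟨ +-suc (h (X ∪ Y)) (h (X ∩ Y)) ⟩
    suc (h (X ∪ Y) + h (X ∩ Y)) ≤⟨ ≤∧≢⇒< (submodular X Y) (λ mod → X∩Y∉M (modular-∩ mod X∈M Y∈M)) ⟩
    h X + h Y                   ≡⟨ cong₂ _+_ (rank-∈ X∈M) (rank-∈ Y∈M) ⟨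
    rank X + rank Y             ∎
    where X∪Y∈M = upward (p⊆p∪q Y) X∈M

  rank-submodular : ∀ X Y → rank (X ∪ Y) + rank (X ∩ Y) ≤ rank X + rank Y
  rank-submodular X Y with toSum (M? X) | toSum (M? Y)
  ... | inj₁ X∈M | inj₁ Y∈M = rank-submodular-∈∈ X∈M Y∈M
  ... | inj₁ X∈M | inj₂ Y∉M = rank-submodular-∈∉ X∈M Y∉M
  ... | inj₂ X∉M | inj₁ Y∈M =
    subst₂ _≤_ (cong₂ _+_ (cong rank (∪-comm Y X)) (cong rank (∩-comm Y X))) (+-comm (rank Y) (rank X))
      (rank-submodular-∈∉ Y∈M X∉M)
  ... | inj₂ X∉M | inj₂ Y∉M = begin
    rank (X ∪ Y) + rank (X ∩ Y)       ≤⟨ +-mono-≤ (rank≤suc (X ∪ Y)) (rank≤suc (X ∩ Y)) ⟩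
    suc (h (X ∪ Y)) + suc (h (X ∩ Y)) ≤⟨ suc-+-mono-≤ (submodular X Y) ⟩
    suc (h X) + suc (h Y)             ≡⟨ cong₂ _+_ (rank-∉ X∉M) (rank-∉ Y∉M) ⟨
    rank X + rank Y                   ∎

  rank-submodular-mixed : ∀ X Y → rank (X ∪ Y) + h (X ∩ Y) ≤ h X + rank Y
  rank-submodular-mixed X Y with toSum (M? Y)
  ... | inj₁ Y∈M = begin
    rank (X ∪ Y) + h (X ∩ Y) ≡⟨ cong (_+ h (X ∩ Y)) (rank-∈ (upward (q⊆p∪q X Y) Y∈M)) ⟩
    h (X ∪ Y) + h (X ∩ Y)    ≤⟨ submodular X Y ⟩
    h X + h Y                ≡⟨ cong (h X +_) (rank-∈ Y∈M) ⟨
    h X + rank Y             ∎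
  ... | inj₂ Y∉M = begin
    rank (X ∪ Y) + h (X ∩ Y)      ≤⟨ +-monoˡ-≤ (h (X ∩ Y)) (rank≤suc (X ∪ Y)) ⟩
    suc (h (X ∪ Y) + h (X ∩ Y))   ≤⟨ s≤s (submodular X Y) ⟩
    suc (h X + h Y)               ≡⟨ +-suc (h X) (h Y) ⟨
    h X + suc (h Y)               ≡⟨ cong (h X +_) (rank-∉ Y∉M) ⟨
    h X + rank Y                  ∎

  extends : Extends h rank
  extends = record
    { h≤H              = h≤rank
    ; monotone         = rank-monotone
    ; submodular       = rank-submodular
    ; submodular-mixed = rank-submodular-mixed
    }

  commonInfo : ∀ {A B} → M A → M B → ¬ M ∅ → 1 + h (A ∪ B) ≡ h A + h B
             → IsCommonInfoSet (extend h rank) new (lift A) (lift B)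
  commonInfo {A} {B} A∈M B∈M ∅∉M modular =
    extend-commonInfo {H = rank} {A} {B} (rank-∈ A∈M) (rank-∈ B∈M)
      (trans (cong (_+ h (A ∪ B)) (trans (rank-∉ ∅∉M) (cong suc normalized))) modular)

-- Rank at most three

two-lines-ranks : ∀ {a b u} → a < u → b < u → u < a + b → u ≤ 3 → a ≡ 2 × b ≡ 2 × u ≡ 3
two-lines-ranks {a} {b} {u} a<u b<u u<a+b u≤3 = a≡2 , b≡2 , u≡3
  where
  open ≤-Reasoning
  u≡3 : u ≡ 3
  u≡3 = ≤-antisym u≤3 (+-cancelʳ-≤ u 3 u (begin
    3 + u         ≤⟨ s≤s (s≤s u<a+b) ⟩
    2 + (a + b)   ≡⟨ cong suc (+-suc a b) ⟨
    suc a + suc b ≤⟨ +-mono-≤ a<u b<u ⟩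
    u + u         ∎))
  a≤2 : a ≤ 2
  a≤2 = ≤-pred (subst (a <_) u≡3 a<u)
  b≤2 : b ≤ 2
  b≤2 = ≤-pred (subst (b <_) u≡3 b<u)
  4≤a+b : 4 ≤ a + b
  4≤a+b = subst (_< a + b) u≡3 u<a+b
  a≡2 : a ≡ 2
  a≡2 = ≤-antisym a≤2 (+-cancelʳ-≤ 2 2 a (≤-trans 4≤a+b (+-monoʳ-≤ a b≤2)))
  b≡2 : b ≡ 2
  b≡2 = ≤-antisym b≤2 (+-cancelˡ-≤ 2 2 b (≤-trans 4≤a+b (+-monoˡ-≤ b a≤2)))

module RankAtMostThree {n : ℕ} {h : Subset n → ℕ} (poly : IsIntPolymatroid h) (h⊤≤3 : h ⊤ ≤ 3) where
  open IsIntPolymatroid poly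
  open IntPolymatroid poly

  h≤3 : ∀ X → h X ≤ 3
  h≤3 X = ≤-trans (monotone ⊆⊤) h⊤≤3

  spans-rank-2 : ∀ {X S T} → Spans h X S → ¬ Spans h X T → h S ≡ 2 → h X ≡ 2
  spans-rank-2 {X} {S} {T} X↠S X↛T hS≡2 = ≤-antisym
    (≤-pred (≤-trans (≤∧≢⇒< (monotone (p⊆p∪q T)) (λ eq → X↛T (sym eq))) (h≤3 (X ∪ T))))
    (subst (_≤ h X) hS≡2 (spans⇒≤ X↠S))

  module TwoLines {A B : Subset n} (noCommonInfoSet : ∀ S → ¬ IsCommonInfoSet h S A B) where

    hA<hA∪B : h A < h (A ∪ B)
    hA<hA∪B = ≤∧≢⇒< (monotone (p⊆p∪q B)) λ hA≡hA∪B → noCommonInfoSet B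
      (sym hA≡hA∪B , spans-refl B , trans (cong (h B +_) (sym hA≡hA∪B)) (+-comm (h B) (h A)))

    hB<hA∪B : h B < h (A ∪ B)
    hB<hA∪B = ≤∧≢⇒< (monotone (q⊆p∪q A B)) λ hB≡hA∪B → noCommonInfoSet A
      (spans-refl A , trans (cong h (∪-comm B A)) (sym hB≡hA∪B) , cong (h A +_) (sym hB≡hA∪B))

    hA∪B<hA+hB : h (A ∪ B) < h A + h B
    hA∪B<hA+hB = ≤∧≢⇒< (≤-trans (m≤m+n (h (A ∪ B)) (h (A ∩ B))) (submodular A B)) λ hA∪B≡hA+hB →
      noCommonInfoSet ∅ (spans-∅ A , spans-∅ B , trans (cong (_+ h (A ∪ B)) normalized) hA∪B≡hA+hB)

    ranks : h A ≡ 2 × h B ≡ 2 × h (A ∪ B) ≡ 3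
    ranks = two-lines-ranks hA<hA∪B hB<hA∪B hA∪B<hA+hB (h≤3 (A ∪ B))

    hA≡2 : h A ≡ 2
    hA≡2 = proj₁ ranks
    hB≡2 : h B ≡ 2
    hB≡2 = proj₁ (proj₂ ranks)
    hA∪B≡3 : h (A ∪ B) ≡ 3
    hA∪B≡3 = proj₂ (proj₂ ranks)

    SpansLine : Subset n → Set
    SpansLine X = Spans h X A ⊎ Spans h X B

    crossing-lines : ∀ {X Y} → IsModularPair h X Y → Spans h X A → Spans h Y B → SpansLine (X ∩ Y)
    crossing-lines {X} {Y} mod X↠A Y↠B with spans? h X B | spans? h Y A
    ... | yes X↠B | _        = inj₂ (spans-∩ mod X↠B Y↠B)
    ... | no _    | yes Y↠A = inj₁ (spans-∩ mod X↠A Y↠A)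
    ... | no X↛B  | no Y↛A  = ⊥-elim (noCommonInfoSet (X ∩ Y)
      (spans-subset X↠A (trans hX≡2 (sym hA≡2)) (p∩q⊆p X Y) ,
       spans-subset Y↠B (trans hY≡2 (sym hB≡2)) (p∩q⊆q X Y) ,
       trans (cong₂ _+_ hX∩Y≡1 hA∪B≡3) (sym (cong₂ _+_ hA≡2 hB≡2))))
      where
      hX≡2 : h X ≡ 2
      hX≡2 = spans-rank-2 X↠A X↛B hA≡2
      hY≡2 : h Y ≡ 2
      hY≡2 = spans-rank-2 Y↠B Y↛A hB≡2
      hX∪Y≡3 : h (X ∪ Y) ≡ 3
      hX∪Y≡3 = ≤-antisym (h≤3 (X ∪ Y)) (subst (_≤ h (X ∪ Y)) hA∪B≡3
        (spans⇒≤ (spans-∪ (spans-mono (p⊆p∪q Y) X↠A) (spans-mono (q⊆p∪q X Y) Y↠B))))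
      hX∩Y≡1 : h (X ∩ Y) ≡ 1
      hX∩Y≡1 = +-cancelˡ-≡ 3 (h (X ∩ Y)) 1
        (trans (cong (_+ h (X ∩ Y)) (sym hX∪Y≡3)) (trans mod (cong₂ _+_ hX≡2 hY≡2)))

    lines-cut : IsModularCut h SpansLine
    lines-cut = record
      { upward    = λ X⊆Y → Sum.map (spans-mono X⊆Y) (spans-mono X⊆Y)
      ; closed    = λ X⊆Y hX≡hY → Sum.map (spans-restrict X⊆Y hX≡hY) (spans-restrict X⊆Y hX≡hY)
      ; modular-∩ = meet
      }
      where
      meet : ∀ {X Y} → IsModularPair h X Y → SpansLine X → SpansLine Y → SpansLine (X ∩ Y)
      meet mod (inj₁ X↠A) (inj₁ Y↠A) = inj₁ (spans-∩ mod X↠A Y↠A)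
      meet mod (inj₂ X↠B) (inj₂ Y↠B) = inj₂ (spans-∩ mod X↠B Y↠B)
      meet mod (inj₁ X↠A) (inj₂ Y↠B) = crossing-lines mod X↠A Y↠B
      meet {X} {Y} mod (inj₂ X↠B) (inj₁ Y↠A) =
        subst SpansLine (∩-comm Y X) (crossing-lines (isModularPair-comm {h = h} mod) Y↠A X↠B)

    intersection-extension : CommonInfoExtension h A B
    intersection-extension = record
      { H          = rank
      ; extends    = extends
      ; H⊤≡h⊤      = rank-∈ (inj₁ (cong h (∪-zeroˡ A)))
      ; commonInfo = commonInfo (inj₁ (spans-refl A)) (inj₂ (spans-refl B)) ∅∉SpansLine
                       (trans (cong (1 +_) hA∪B≡3) (sym (cong₂ _+_ hA≡2 hB≡2)))
      }
      where
      open ModularCutExtension poly (λ X → spans? h X A ⊎-dec spans? h X B) lines-cut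
      ∅∉SpansLine : ¬ SpansLine ∅
      ∅∉SpansLine (inj₁ ∅↠A) with trans (sym hA≡2) (trans (cong h (sym (∪-identityˡ A))) (trans ∅↠A normalized))
      ... | ()
      ∅∉SpansLine (inj₂ ∅↠B) with trans (sym hB≡2) (trans (cong h (sym (∪-identityˡ B))) (trans ∅↠B normalized))
      ... | ()

  commonInfoExtension : ∀ A B → CommonInfoExtension h A B
  commonInfoExtension A B with anySubset? (isCommonInfoSet? h A B)
  ... | yes (S , S-commonInfo) = record
    { H          = λ X → h (X ∪ S)
    ; extends    = copy-extends poly S
    ; H⊤≡h⊤      = cong h (∪-zeroˡ S)
    ; commonInfo = copy-commonInfo poly S-commonInfo
    }
  ... | no ∄S = TwoLines.intersection-extension (λ S S-commonInfo → ∄S (S , S-commonInfo))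

-- Natural numbers as rationals

ℕ→ℚ≡mkℚ : ∀ m → ℕ→ℚ m ≡ ℚ.mkℚ (ℤ.+ m) 0 (Coprimality.sym (1-coprimeTo m))
ℕ→ℚ≡mkℚ m = ℚₚ.normalize-coprime _

ℕ→ℚ-mono-≤ : ∀ {a b} → a ≤ b → ℕ→ℚ a ℚ.≤ ℕ→ℚ b
ℕ→ℚ-mono-≤ {a} {b} a≤b rewrite ℕ→ℚ≡mkℚ a | ℕ→ℚ≡mkℚ b =
  ℚ.*≤* (subst₂ ℤ._≤_ (sym (ℤₚ.*-identityʳ (ℤ.+ a))) (sym (ℤₚ.*-identityʳ (ℤ.+ b))) (+≤+ a≤b))

ℕ→ℚ-cancel-≤ : ∀ {a b} → ℕ→ℚ a ℚ.≤ ℕ→ℚ b → a ≤ b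
ℕ→ℚ-cancel-≤ {a} {b} le rewrite ℕ→ℚ≡mkℚ a | ℕ→ℚ≡mkℚ b with le
... | ℚ.*≤* a*1≤b*1 with subst₂ ℤ._≤_ (ℤₚ.*-identityʳ (ℤ.+ a)) (ℤₚ.*-identityʳ (ℤ.+ b)) a*1≤b*1
... | +≤+ a≤b = a≤b

ℕ→ℚ-injective : ∀ {a b} → ℕ→ℚ a ≡ ℕ→ℚ b → a ≡ b
ℕ→ℚ-injective eq = ≤-antisym (ℕ→ℚ-cancel-≤ (ℚₚ.≤-reflexive eq)) (ℕ→ℚ-cancel-≤ (ℚₚ.≤-reflexive (sym eq)))

ℕ→ℚ-homo-+ : ∀ a b → ℕ→ℚ (a + b) ≡ ℕ→ℚ a ℚ.+ ℕ→ℚ b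
ℕ→ℚ-homo-+ a b =
  ℚₚ.toℚᵘ-injective (ℚᵘₚ.≃-trans toℚᵘ-sum (ℚᵘₚ.≃-sym (ℚₚ.toℚᵘ-homo-+ (ℕ→ℚ a) (ℕ→ℚ b))))
  where
  open ≡-Reasoning
  toℚᵘ-sum : ℚ.toℚᵘ (ℕ→ℚ (a + b)) ℚᵘ.≃ ℚ.toℚᵘ (ℕ→ℚ a) ℚᵘ.+ ℚ.toℚᵘ (ℕ→ℚ b)
  toℚᵘ-sum rewrite ℕ→ℚ≡mkℚ (a + b) | ℕ→ℚ≡mkℚ a | ℕ→ℚ≡mkℚ b = ℚᵘ.*≡* (begin
    ℤ.+ (a + b) ℤ.* ℤ.+ 1                             ≡⟨ ℤₚ.*-identityʳ (ℤ.+ (a + b)) ⟩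
    ℤ.+ a ℤ.+ ℤ.+ b                                   ≡⟨ cong₂ ℤ._+_ (ℤₚ.*-identityʳ (ℤ.+ a)) (ℤₚ.*-identityʳ (ℤ.+ b)) ⟨
    ℤ.+ a ℤ.* ℤ.+ 1 ℤ.+ ℤ.+ b ℤ.* ℤ.+ 1               ≡⟨ ℤₚ.*-identityʳ _ ⟨
    (ℤ.+ a ℤ.* ℤ.+ 1 ℤ.+ ℤ.+ b ℤ.* ℤ.+ 1) ℤ.* ℤ.+ 1 ∎)

nonNegative-integer : ∀ z → ℚ.0ℚ ℚ.≤ z ℚ./ 1 → z ℚ./ 1 ≡ ℕ→ℚ ℤ.∣ z ∣
nonNegative-integer (ℤ.+ m)  _   = refl
nonNegative-integer -[1+ k ] 0≤z with subst (λ q → ℚ.0ℚ ℚ.≤ ℚ.- q) (ℕ→ℚ≡mkℚ (suc k)) 0≤z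
... | ℚ.*≤* ()

ℕ→ℚ-cong-+ : ∀ a b c d → a + b ≡ c + d → ℕ→ℚ a ℚ.+ ℕ→ℚ b ≡ ℕ→ℚ c ℚ.+ ℕ→ℚ d
ℕ→ℚ-cong-+ a b c d a+b≡c+d = trans (sym (ℕ→ℚ-homo-+ a b)) (trans (cong ℕ→ℚ a+b≡c+d) (ℕ→ℚ-homo-+ c d))

module _ where
  open ≡-Reasoning
  open +-*-Solver

  -≡-⇐+≡+ : ∀ p q r s → p ℚ.+ s ≡ r ℚ.+ q → p ℚ.- q ≡ r ℚ.- s
  -≡-⇐+≡+ p q r s p+s≡r+q = begin
    p ℚ.- q                 ≡⟨ solve 3 (λ p q s → p :- q := (p :+ s) :- (s :+ q)) refl p q s ⟩
    (p ℚ.+ s) ℚ.- (s ℚ.+ q) ≡⟨ cong (ℚ._- (s ℚ.+ q)) p+s≡r+q ⟩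
    (r ℚ.+ q) ℚ.- (s ℚ.+ q) ≡⟨ solve 3 (λ q r s → (r :+ q) :- (s :+ q) := r :- s) refl q r s ⟩
    r ℚ.- s                 ∎

  ≡-⇐+≡ : ∀ p q r → p ℚ.+ q ≡ r → p ≡ r ℚ.- q
  ≡-⇐+≡ p q r p+q≡r = begin
    p                 ≡⟨ solve 2 (λ p q → p := (p :+ q) :- q) refl p q ⟩
    (p ℚ.+ q) ℚ.- q   ≡⟨ cong (ℚ._- q) p+q≡r ⟩
    r ℚ.- q           ∎

  ≡⇒-≡0 : ∀ {p q} → p ≡ q → p ℚ.- q ≡ ℚ.0ℚ
  ≡⇒-≡0 {q = q} refl = ℚₚ.+-inverseʳ q

ℕ→ℚ-+≡⇒-≡- : ∀ a b c d → a + d ≡ c + b → ℕ→ℚ a ℚ.- ℕ→ℚ b ≡ ℕ→ℚ c ℚ.- ℕ→ℚ d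
ℕ→ℚ-+≡⇒-≡- a b c d a+d≡c+b = -≡-⇐+≡+ (ℕ→ℚ a) (ℕ→ℚ b) (ℕ→ℚ c) (ℕ→ℚ d) (ℕ→ℚ-cong-+ a d c b a+d≡c+b)

ℕ→ℚ-+≡⇒≡- : ∀ x u a b → x + u ≡ a + b → ℕ→ℚ x ≡ (ℕ→ℚ a ℚ.+ ℕ→ℚ b) ℚ.- ℕ→ℚ u
ℕ→ℚ-+≡⇒≡- x u a b x+u≡a+b = ≡-⇐+≡ (ℕ→ℚ x) (ℕ→ℚ u) (ℕ→ℚ a ℚ.+ ℕ→ℚ b) (ℕ→ℚ-cong-+ x u a b x+u≡a+b)

commonInfo-ℚ : ∀ {n} {G : Subset (suc n) → ℕ} {A B} → IsCommonInfoSet G new (lift A) (lift B)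
             → IsCommonInfo (λ X → ℕ→ℚ (G X)) A B
commonInfo-ℚ {G = G} {A} {B} (A↠new , B↠new , modular) =
  ≡⇒-≡0 (cong ℕ→ℚ A↠new) , ≡⇒-≡0 (cong ℕ→ℚ B↠new) ,
  ℕ→ℚ-+≡⇒≡- (G new) (G (lift A ∪ lift B)) (G (lift A)) (G (lift B)) modular

akInfo-ℚ : ∀ {n} {G : Subset (suc n) → ℕ} {U V Z} → IsIntPolymatroid G
         → IsCommonInfoSet G new (lift Z) (lift (U ∪ V)) → IsAKInfo (λ X → ℕ→ℚ (G X)) U V Z
akInfo-ℚ {G = G} {U} {V} {Z} poly commonInfo@(_ , U∪V↠new , _) =
  ≡⇒-≡0 (cong ℕ→ℚ U∪V↠new) ,
  conditional (p⊆p∪q V) , conditional (q⊆p∪q U V) , conditional ⊆-refl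
  where
  g : SetFn (suc _)
  g X = ℕ→ℚ (G X)

  conditional : ∀ {T} → T ⊆ U ∪ V → cond g (lift T) new ≡ cond g (lift T) (lift Z)
  conditional {T} T⊆U∪V =
    ℕ→ℚ-+≡⇒-≡- (G (new ∪ lift T)) (G new) (G (lift Z ∪ lift T)) (G (lift Z))
      (IntPolymatroid.commonInfo-conditional poly commonInfo (out⊆ T⊆U∪V))

record IntPolymatroidRank≤3 {n : ℕ} (f : SetFn n) : Set where
  field
    h                : Subset n → ℕ
    isIntPolymatroid : IsIntPolymatroid h
    h⊤≤3             : h ⊤ ≤ 3
    f≡h              : ∀ X → f X ≡ ℕ→ℚ (h X)

isPolymatroid : ∀ {n} {h : Subset n → ℕ} → IsIntPolymatroid h → IsPolymatroid (λ X → ℕ→ℚ (h X))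
isPolymatroid {h = h} poly = record
  { normalized = cong ℕ→ℚ P.normalized
  ; monotone   = λ X Y X⊆Y → ℕ→ℚ-mono-≤ (P.monotone X⊆Y)
  ; submodular = λ X Y → subst₂ ℚ._≤_ (ℕ→ℚ-homo-+ (h (X ∪ Y)) (h (X ∩ Y))) (ℕ→ℚ-homo-+ (h X) (h Y))
                                      (ℕ→ℚ-mono-≤ (P.submodular X Y))
  }
  where module P = IsIntPolymatroid poly

matroid⇒intPolymatroidRank≤3 : ∀ {n} {f : SetFn n} → IsMatroid f → HasRank f 3 → IntPolymatroidRank≤3 f
matroid⇒intPolymatroidRank≤3 {n} {f} matroid rank≡3 = record
  { h                = h
  ; isIntPolymatroid = record
    { normalized = ℕ→ℚ-injective (trans (sym (f≡h ∅)) normalized)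
    ; monotone   = λ {X} {Y} X⊆Y → ℕ→ℚ-cancel-≤ (subst₂ ℚ._≤_ (f≡h X) (f≡h Y) (monotone X Y X⊆Y))
    ; submodular = λ X Y → ℕ→ℚ-cancel-≤ (subst₂ ℚ._≤_
        (trans (cong₂ ℚ._+_ (f≡h (X ∪ Y)) (f≡h (X ∩ Y))) (sym (ℕ→ℚ-homo-+ (h (X ∪ Y)) (h (X ∩ Y)))))
        (trans (cong₂ ℚ._+_ (f≡h X) (f≡h Y)) (sym (ℕ→ℚ-homo-+ (h X) (h Y))))
        (submodular X Y))
    }
  ; h⊤≤3             = ≤-reflexive (ℕ→ℚ-injective (trans (sym (f≡h ⊤)) rank≡3))
  ; f≡h              = f≡h
  }
  where
  open IsMatroid matroid
  open IsPolymatroid polymatroid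

  h : Subset n → ℕ
  h X = ℤ.∣ proj₁ (integerValued X) ∣

  f≡h : ∀ X → f X ≡ ℕ→ℚ (h X)
  f≡h X with integerValued X
  ... | z , fX≡z = trans fX≡z (nonNegative-integer z (subst₂ ℚ._≤_ normalized fX≡z (monotone ∅ X (⊆-min X))))

module _ {n : ℕ} {f : SetFn n} (F : IntPolymatroidRank≤3 f) where
  open IntPolymatroidRank≤3 F
  open RankAtMostThree isIntPolymatroid h⊤≤3 using (commonInfoExtension)

  private
    image : ∀ {A B} → CommonInfoExtension h A B → SetFn (suc n)
    image E X = ℕ→ℚ (extend h (CommonInfoExtension.H E) X)

    image-isIntPolymatroid : ∀ {A B} (E : CommonInfoExtension h A B)
                           → IsIntPolymatroid (extend h (CommonInfoExtension.H E))
    image-isIntPolymatroid E = extend-isIntPolymatroid isIntPolymatroid (CommonInfoExtension.extends E)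

    image-extension : ∀ {A B} (E : CommonInfoExtension h A B)
                    → IsExtension f (image E) × IntPolymatroidRank≤3 (image E)
    image-extension E =
      (isPolymatroid (image-isIntPolymatroid E) , λ X → sym (f≡h X)) ,
      record
        { h                = extend h (CommonInfoExtension.H E)
        ; isIntPolymatroid = image-isIntPolymatroid E
        ; h⊤≤3             = subst (_≤ 3) (sym (CommonInfoExtension.H⊤≡h⊤ E)) h⊤≤3
        ; f≡h              = λ X → refl
        }

  commonInfo-step : ∀ A B → ∃ λ g → IsExtension f g × IsCommonInfo g A B × IntPolymatroidRank≤3 g
  commonInfo-step A B =
    image E , g-extension , commonInfo-ℚ {G = extend h (CommonInfoExtension.H E)} (CommonInfoExtension.commonInfo E) , G
    where
    E = commonInfoExtension A B
    g-extension = proj₁ (image-extension E)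
    G = proj₂ (image-extension E)

  akInfo-step : ∀ U V Z → ∃ λ g → IsExtension f g × IsAKInfo g U V Z × IntPolymatroidRank≤3 g
  akInfo-step U V Z =
    image E , g-extension , akInfo-ℚ (image-isIntPolymatroid E) (CommonInfoExtension.commonInfo E) , G
    where
    E = commonInfoExtension Z (U ∪ V)
    g-extension = proj₁ (image-extension E)
    G = proj₂ (image-extension E)

module _ (P : ∀ {n} → SetFn n → Set) where

  closed⇒CICompliantK : (∀ {n} {f : SetFn n} → P f → ∀ A B → ∃ λ g → IsExtension f g × IsCommonInfo g A B × P g)
                      → ∀ k {n} {f : SetFn n} → P f → CICompliantK k f
  closed⇒CICompliantK step zero    _  = tt
  closed⇒CICompliantK step (suc k) Pf A B =
    let g , g-extension , g-commonInfo , Pg = step Pf A B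
    in  g , g-extension , g-commonInfo , closed⇒CICompliantK step k Pg

  closed⇒AKCompliantK : (∀ {n} {f : SetFn n} → P f → ∀ U V Z → ∃ λ g → IsExtension f g × IsAKInfo g U V Z × P g)
                      → ∀ k {n} {f : SetFn n} → P f → AKCompliantK k f
  closed⇒AKCompliantK step zero    _  = tt
  closed⇒AKCompliantK step (suc k) Pf U V Z =
    let g , g-extension , g-akInfo , Pg = step Pf U V Z
    in  g , g-extension , g-akInfo , closed⇒AKCompliantK step k Pg

mainTheorem6 : (n : ℕ) (f : SetFn n) → IsMatroid f → HasRank f 3
    → CICompliant f × AKCompliant f
mainTheorem6 n f matroid rank≡3 =
  (λ k → closed⇒CICompliantK IntPolymatroidRank≤3 commonInfo-step k F) ,
  (λ k → closed⇒AKCompliantK IntPolymatroidRank≤3 akInfo-step k F)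
  where
  F : IntPolymatroidRank≤3 f
  F = matroid⇒intPolymatroidRank≤3 matroid rank≡3
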